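{- Let $\Omega$ be a finite set and $\zeta\in\mathrm{Sym}(\Omega)$. Then there is $\tau\in\mathrm{Sym}(\Omega)$ with $\tau^2=\mathrm{Id}$ and $d_H(\zeta,\tau)=d_H(\zeta^2,\mathrm{Id})$.
   Context: For $\sigma,\sigma'\in\mathrm{Sym}(\Omega)$, $d_H(\sigma,\sigma')=\Pr_{\star\in\Omega}[\sigma.\star\ne\sigma'.\star]$ is the normalized Hamming distance (uniform probability on $\Omega$). -}

module Defs where

open import Data.Nat using (ℕ)
open import Data.Fin using (Fin; _≟_)
open import Data.Fin.Permutation using (Permutation′; _⟨$⟩ʳ_; _∘ₚ_)
open import Data.List using (length; filter)
open import Data.List.Base using (allFin)
open import Relation.Nullary.Decidable using (¬?)

-- Ω is modelled as Fin n (any finite set is in bijection with some Fin n);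
-- Sym(Ω) is Permutation′ n.

-- The normalised Hamming distance
-- d_H(σ,σ') is this count divided by |Ω| = n; since both sides of the claimed
-- equality have the same denominator n, equality of d_H is equality of counts.
hammingCount : ∀ {n} → Permutation′ n → Permutation′ n → ℕ
hammingCount {n} σ σ′ =
  length (filter (λ x → ¬? ((σ ⟨$⟩ʳ x) ≟ (σ′ ⟨$⟩ʳ x))) (allFin n))

-- Let τ agree with ζ on the points lying in cycles of length at most two of ζ
-- and fix every other point.  Then τ is an involution, and ζ.x ≠ τ.x holds
-- exactly when ζ².x ≠ x: on short cycles both sides are equalities, and off
-- them τ.x = x while ζ.x ≠ x.
module Submission where

open import Defs
open import Data.Nat using (ℕ)
open import Data.Fin using (Fin)
import Data.Fin as Fin
open import Data.Fin.Permutation using (Permutation′; _⟨$⟩ʳ_; _∘ₚ_; id; permutation)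
open import Data.Product using (Σ; _×_; _,_)
open import Data.List using (length)
open import Data.List.Base using (allFin)
open import Data.List.Properties using (filter-≐)
open import Relation.Nullary using (yes; no; contradiction)
open import Relation.Nullary.Decidable using (¬?)
open import Relation.Binary.Definitions using (DecidableEquality)
open import Relation.Binary.PropositionalEquality using (_≡_; _≢_; refl; cong; sym; trans)

module TwoCyclePart {a} {A : Set a} (_≟_ : DecidableEquality A) (f : A → A) where

  twoCyclePart : A → A
  twoCyclePart x with f (f x) ≟ x
  ... | yes _ = f x
  ... | no  _ = x

  twoCyclePart-on : ∀ {x} → f (f x) ≡ x → twoCyclePart x ≡ f x
  twoCyclePart-on {x} ffx≡x with f (f x) ≟ x
  ... | yes _     = refl
  ... | no  ffx≢x = contradiction ffx≡x ffx≢x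

  twoCyclePart-off : ∀ {x} → f (f x) ≢ x → twoCyclePart x ≡ x
  twoCyclePart-off {x} ffx≢x with f (f x) ≟ x
  ... | yes ffx≡x = contradiction ffx≡x ffx≢x
  ... | no  _     = refl

  twoCyclePart-involutive : ∀ x → twoCyclePart (twoCyclePart x) ≡ x
  twoCyclePart-involutive x with f (f x) ≟ x
  ... | yes ffx≡x = trans (twoCyclePart-on (cong f ffx≡x)) ffx≡x
  ... | no  ffx≢x = twoCyclePart-off ffx≢x

  ≢twoCyclePart⇒≢ : ∀ {x} → f x ≢ twoCyclePart x → f (f x) ≢ x
  ≢twoCyclePart⇒≢ fx≢tx ffx≡x = fx≢tx (sym (twoCyclePart-on ffx≡x))

  ≢⇒≢twoCyclePart : ∀ {x} → f (f x) ≢ x → f x ≢ twoCyclePart x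
  ≢⇒≢twoCyclePart {x} ffx≢x fx≡tx = ffx≢x (trans (cong f fx≡x) fx≡x)
    where
    fx≡x : f x ≡ x
    fx≡x = trans fx≡tx (twoCyclePart-off ffx≢x)

hammingCount-cong : ∀ {n} {σ σ′ ρ ρ′ : Permutation′ n} →
  (∀ {x} → σ ⟨$⟩ʳ x ≢ σ′ ⟨$⟩ʳ x → ρ ⟨$⟩ʳ x ≢ ρ′ ⟨$⟩ʳ x) →
  (∀ {x} → ρ ⟨$⟩ʳ x ≢ ρ′ ⟨$⟩ʳ x → σ ⟨$⟩ʳ x ≢ σ′ ⟨$⟩ʳ x) →
  hammingCount σ σ′ ≡ hammingCount ρ ρ′
hammingCount-cong {n} {σ} {σ′} {ρ} {ρ′} σ⇒ρ ρ⇒σ = cong length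
  (filter-≐ (λ x → ¬? ((σ ⟨$⟩ʳ x) Fin.≟ (σ′ ⟨$⟩ʳ x)))
            (λ x → ¬? ((ρ ⟨$⟩ʳ x) Fin.≟ (ρ′ ⟨$⟩ʳ x)))
            (σ⇒ρ , ρ⇒σ) (allFin n))

involution : ∀ {n} (t : Fin n → Fin n) → (∀ x → t (t x) ≡ x) → Permutation′ n
involution t t-involutive = permutation t t t-involutive t-involutive

claim2p2 : (n : ℕ) → (ζ : Permutation′ n) →
    Σ (Permutation′ n) (λ τ →
    (∀ x → (τ ∘ₚ τ) ⟨$⟩ʳ x ≡ x) ×
    (hammingCount ζ τ ≡ hammingCount (ζ ∘ₚ ζ) id))
claim2p2 n ζ = τ , twoCyclePart-involutive ,
  hammingCount-cong {σ = ζ} {τ} {ζ ∘ₚ ζ} {id} ≢twoCyclePart⇒≢ ≢⇒≢twoCyclePart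
  where
  open TwoCyclePart Fin._≟_ (ζ ⟨$⟩ʳ_)

  τ : Permutation′ n
  τ = involution twoCyclePart twoCyclePart-involutive
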